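{- Let $n\in\mathbb{N}$ and $1\le j\le n$. Then $$c_{(j,\underbrace{1,\ldots,1}_{n-j},0,\ldots,0)}=j^{\,n-j},$$ where the vector has $n$ entries: first $j$, then $n-j$ ones, then $j-1$ zeros.
   Context: For $n\in\mathbb{N}$ and indeterminates $x_1,\ldots,x_n$, let $p_n=x_1(x_1+x_2)\cdots(x_1+x_2+\cdots+x_n)$. For a vector $(a_1,\ldots,a_n)$ of nonnegative integers, $c_{(a_1,\ldots,a_n)}$ denotes the coefficient of $x_1^{a_1}\cdots x_n^{a_n}$ in the expansion of $p_n$. -}

module Defs where

open import Data.Nat using (ℕ; zero; suc; _+_; _*_; _∸_; _<ᵇ_)
open import Data.Nat.Properties using (_≟_)
open import Data.Bool using (if_then_else_)
open import Data.Fin using (Fin; toℕ)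
open import Data.Product using (_×_; _,_)
open import Data.List using (List; []; _∷_; concatMap; map; upTo; foldr)
open import Data.Nat.ListAction using (sum)
open import Data.Vec using (Vec; tabulate; zipWith; replicate)
open import Data.Vec.Properties using (≡-dec)
open import Relation.Nullary.Decidable using (⌊_⌋)

-- A polynomial in n variables x_1,…,x_n with natural-number coefficients,
-- represented as a formal (unreduced) sum of terms c · x^e, where the
-- exponent vector e : Vec ℕ n lists the exponents of x_1,…,x_n.
Poly : ℕ → Set
Poly n = List (ℕ × Vec ℕ n)

one : ∀ {n} → Poly n
one {n} = (1 , replicate n 0) ∷ []

_⊗_ : ∀ {n} → Poly n → Poly n → Poly n
p ⊗ q = concatMap (λ { (c , e) → map (λ { (d , f) → (c * d , zipWith _+_ e f) }) q }) p

-- the variable x_{i+1} (i : Fin n is 0-based)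
var : ∀ {n} → Fin n → Poly n
var {n} i = (1 , tabulate (λ k → if toℕ k Data.Nat.≡ᵇ toℕ i then 1 else 0)) ∷ []
  where import Data.Nat

-- the linear form x_1 + x_2 + ⋯ + x_k (k ≤ n; variables with 0-based index < k)
partialSum : ∀ {n} → ℕ → Poly n
partialSum {n} k = concatMap (λ i → if toℕ i <ᵇ k then var i else []) (Data.List.allFin n)
  where import Data.List

-- p_n = x_1 (x_1 + x_2) ⋯ (x_1 + ⋯ + x_n)
p : (n : ℕ) → Poly n
p n = foldr (λ k acc → acc ⊗ partialSum (suc k)) one (upTo n)

coeff : ∀ {n} → Vec ℕ n → Poly n → ℕ
coeff a q = sum (map (λ { (c , e) → if ⌊ ≡-dec _≟_ e a ⌋ then c else 0 }) q)

c : (n : ℕ) → Vec ℕ n → ℕ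
c n a = coeff a (p n)

-- the exponent vector (j, 1,…,1 (n−j times), 0,…,0 (j−1 times)) of length n:
-- entry with 0-based index i is j if i = 0, 1 if 1 ≤ i ≤ n − j, and 0 otherwise
vecJ : (n j : ℕ) → Vec ℕ n
vecJ n j = tabulate entry
  where
  entry : Fin n → ℕ
  entry i with toℕ i
  ... | zero = j
  ... | suc m = if m <ᵇ (n ∸ j) then 1 else 0

{-# OPTIONS --safe #-}
-- Expand p_n from the factor x₁ upwards: a monomial of p_n is a choice, for every k,
-- of one of x₁, …, x_k. Write n = m + j, so the target exponent is (j, 1, …, 1, 0, …, 0)
-- with m ones. Once the first s + 1 factors are expanded, the exponent still to be
-- produced is (e, b) where b is 0 or 1 on x₂, …, x_{s+1}, is 1 on the fresh variables
-- x_{s+2}, …, x_{m+1} and 0 beyond. Its coefficient in the remaining product is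
-- j^(m−s)·(e+1)(e+2)⋯(e+u), where u counts the ones of b still left among x₂, …, x_{s+1}:
-- expanding one more factor gives a recurrence whose e + u + 1 choices number exactly j
-- (by a degree count) as long as fresh variables remain, and which afterwards is Pascal's
-- rule for the multinomial coefficient (e+u)!/e! of (e, 1, …, 1). The factor x₁ is
-- forced, leaving e = j − 1, s = u = 0, hence j^m.

module Submission where

open import Defs
open import Data.Nat using (ℕ; _≤_; _^_; _∸_)
open import Relation.Binary.PropositionalEquality using (_≡_)

open import Data.Nat using (zero; suc; _+_; _*_; _<_; _<ᵇ_; _≡ᵇ_; pred; z≤n; s≤s; z<s)
open import Data.Nat.Properties
open import Algebra.Properties.CommutativeSemigroup +-commutativeSemigroup using (interchange)
open import Algebra.Properties.CommutativeSemigroup *-commutativeSemigroup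
  using () renaming (x∙yz≈y∙xz to x*[y*z]≡y*[x*z])
open import Data.Nat.Tactic.RingSolver using (solve-∀)
open import Data.Nat.ListAction using (sum)
open import Data.Nat.ListAction.Properties using (sum-++)
open import Data.Bool using (true; false; if_then_else_)
open import Data.Fin using (Fin; toℕ) renaming (zero to fzero; suc to fsuc)
open import Data.Product using (_×_; _,_; proj₁; proj₂)
open import Data.List using ([]; _∷_; _++_; map; concatMap; foldr; applyUpTo; allFin)
import Data.List as List
open import Data.List.Properties using (map-++; map-cong; map-tabulate)
open import Data.Vec using (Vec; []; _∷_; tabulate; zipWith; replicate)
open import Data.Vec.Properties using (≡-dec; ∷-injective)
open import Data.Empty using (⊥-elim)
open import Function using (_∘_)
open import Relation.Nullary using (yes; no; contradiction)
open import Relation.Nullary.Decidable using (⌊_⌋)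
open import Relation.Binary.PropositionalEquality
  using (refl; sym; trans; cong; cong₂; subst; _≢_; module ≡-Reasoning)

infixl 10 _‼_
infixl 6 _⊕_

_‼_ : ∀ {n} → Vec ℕ n → ℕ → ℕ
[]       ‼ _     = 0
(x ∷ _)  ‼ zero  = x
(_ ∷ xs) ‼ suc k = xs ‼ k

decrementAt : ∀ {n} → Vec ℕ n → ℕ → Vec ℕ n
decrementAt []       _       = []
decrementAt (x ∷ xs) zero    = pred x ∷ xs
decrementAt (x ∷ xs) (suc k) = x ∷ decrementAt xs k

‼-out : ∀ {n} (a : Vec ℕ n) {k} → n ≤ k → a ‼ k ≡ 0
‼-out []       _         = refl
‼-out (_ ∷ xs) (s≤s n≤k) = ‼-out xs n≤k

‼-tabulate : ∀ {n} (g : ℕ → ℕ) {k} → k < n → tabulate {n = n} (g ∘ toℕ) ‼ k ≡ g k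
‼-tabulate g {zero}  (s≤s _)   = refl
‼-tabulate g {suc k} (s≤s k<n) = ‼-tabulate (g ∘ suc) k<n

‼-decrementAt-≢ : ∀ {n} (a : Vec ℕ n) {i k} → i ≢ k → decrementAt a i ‼ k ≡ a ‼ k
‼-decrementAt-≢ []       i≢k = refl
‼-decrementAt-≢ (x ∷ xs) {zero}  {zero}  i≢k = ⊥-elim (i≢k refl)
‼-decrementAt-≢ (x ∷ xs) {zero}  {suc k} i≢k = refl
‼-decrementAt-≢ (x ∷ xs) {suc i} {zero}  i≢k = refl
‼-decrementAt-≢ (x ∷ xs) {suc i} {suc k} i≢k = ‼-decrementAt-≢ xs (i≢k ∘ cong suc)

‼-decrementAt-≤ : ∀ {n} (a : Vec ℕ n) i k → decrementAt a i ‼ k ≤ a ‼ k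
‼-decrementAt-≤ []       i       k       = z≤n
‼-decrementAt-≤ (x ∷ xs) zero    zero    = pred[n]≤n
‼-decrementAt-≤ (x ∷ xs) zero    (suc k) = ≤-refl
‼-decrementAt-≤ (x ∷ xs) (suc i) zero    = ≤-refl
‼-decrementAt-≤ (x ∷ xs) (suc i) (suc k) = ‼-decrementAt-≤ xs i k

_⊕_ : ∀ {n} → Vec ℕ n → Vec ℕ n → Vec ℕ n
_⊕_ = zipWith _+_

-- var i ≡ (1 , unit i) ∷ [] holds definitionally.
unit : ∀ {n} → Fin n → Vec ℕ n
unit i = tabulate (λ k → if toℕ k ≡ᵇ toℕ i then 1 else 0)

‼-⊕-unit : ∀ {n} (e : Vec ℕ n) i → (e ⊕ unit i) ‼ toℕ i ≡ suc (e ‼ toℕ i)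
‼-⊕-unit (x ∷ xs) fzero    = +-comm x 1
‼-⊕-unit (x ∷ xs) (fsuc i) = ‼-⊕-unit xs i

decrementAt-⊕-unit : ∀ {n} (a : Vec ℕ n) i {x} → a ‼ toℕ i ≡ suc x →
                     decrementAt a (toℕ i) ⊕ unit i ≡ a
decrementAt-⊕-unit (y ∷ ys) fzero    refl = cong₂ _∷_ (+-comm (pred y) 1) (⊕-zeros ys)
  where
  ⊕-zeros : ∀ {n} (v : Vec ℕ n) → v ⊕ tabulate (λ _ → 0) ≡ v
  ⊕-zeros []       = refl
  ⊕-zeros (z ∷ zs) = cong₂ _∷_ (+-identityʳ z) (⊕-zeros zs)
decrementAt-⊕-unit (y ∷ ys) (fsuc i) aᵢ = cong₂ _∷_ (+-identityʳ y) (decrementAt-⊕-unit ys i aᵢ)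

⊕-cancelʳ : ∀ {n} (e e′ w : Vec ℕ n) → e ⊕ w ≡ e′ ⊕ w → e ≡ e′
⊕-cancelʳ []       []         []       _  = refl
⊕-cancelʳ (x ∷ xs) (x′ ∷ xs′) (y ∷ ys) eq =
  cong₂ _∷_ (+-cancelʳ-≡ y x x′ (proj₁ (∷-injective eq))) (⊕-cancelʳ xs xs′ ys (proj₂ (∷-injective eq)))

∑ : ℕ → (ℕ → ℕ) → ℕ
∑ zero    f = 0
∑ (suc n) f = f 0 + ∑ n (f ∘ suc)

infix 7 ∑
syntax ∑ n (λ i → e) = ∑[ i < n ] e

∑-cong : ∀ n {f g : ℕ → ℕ} → (∀ {i} → i < n → f i ≡ g i) → ∑ n f ≡ ∑ n g
∑-cong zero    f≗g = refl
∑-cong (suc n) f≗g = cong₂ _+_ (f≗g (s≤s z≤n)) (∑-cong n (f≗g ∘ s≤s))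

∑-zero : ∀ n → ∑[ i < n ] 0 ≡ 0
∑-zero zero    = refl
∑-zero (suc n) = ∑-zero n

∑-snoc : ∀ n (f : ℕ → ℕ) → ∑ (suc n) f ≡ ∑ n f + f n
∑-snoc zero    f = +-comm (f 0) 0
∑-snoc (suc n) f = trans (cong (f 0 +_) (∑-snoc n (f ∘ suc))) (sym (+-assoc (f 0) _ _))

∑-*ʳ : ∀ n (f : ℕ → ℕ) c → ∑[ i < n ] (f i * c) ≡ ∑ n f * c
∑-*ʳ zero    f c = refl
∑-*ʳ (suc n) f c = trans (cong (f 0 * c +_) (∑-*ʳ n (f ∘ suc) c)) (sym (*-distribʳ-+ c (f 0) _))

∑-if-<ᵇ : ∀ n k (f : ℕ → ℕ) → k ≤ n → ∑[ i < n ] (if i <ᵇ k then f i else 0) ≡ ∑ k f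
∑-if-<ᵇ n       zero    f _         = ∑-zero n
∑-if-<ᵇ (suc n) (suc k) f (s≤s k≤n) = cong (f 0 +_) (∑-if-<ᵇ n k (f ∘ suc) k≤n)

sum-allFin : ∀ n (f : ℕ → ℕ) → sum (map (f ∘ toℕ) (allFin n)) ≡ ∑ n f
sum-allFin n f = trans (cong sum (map-tabulate {n = n} (λ i → i) (f ∘ toℕ))) (sum-tabulate n f)
  where
  sum-tabulate : ∀ n (f : ℕ → ℕ) → sum (List.tabulate {n = n} (f ∘ toℕ)) ≡ ∑ n f
  sum-tabulate zero    f = refl
  sum-tabulate (suc n) f = cong (f 0 +_) (sum-tabulate n (f ∘ suc))

∑-decrementAt : ∀ {n} (a : Vec ℕ n) {s i x} → i < s → a ‼ i ≡ suc x →
                suc (∑[ k < s ] decrementAt a i ‼ k) ≡ ∑[ k < s ] a ‼ k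
∑-decrementAt []       {i = i}     _         ()
∑-decrementAt (y ∷ ys) {i = zero}  (s≤s _)   refl = refl
∑-decrementAt (y ∷ ys) {i = suc i} (s≤s i<s) aᵢ   =
  trans (sym (+-suc y _)) (cong (y +_) (∑-decrementAt ys i<s aᵢ))

∑-‼≡0 : ∀ {n} (a : Vec ℕ n) → ∑[ k < n ] a ‼ k ≡ 0 → a ≡ replicate n 0
∑-‼≡0 []       _  = refl
∑-‼≡0 (x ∷ xs) eq = cong₂ _∷_ (m+n≡0⇒m≡0 x eq) (∑-‼≡0 xs (m+n≡0⇒n≡0 x eq))

ifPos : ℕ → ℕ → ℕ
ifPos zero    _ = 0
ifPos (suc _) y = y

ifPos-0 : ∀ x → ifPos x 0 ≡ 0
ifPos-0 zero    = refl
ifPos-0 (suc _) = refl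

ifPos-+ : ∀ x y z → ifPos x (y + z) ≡ ifPos x y + ifPos x z
ifPos-+ zero    y z = refl
ifPos-+ (suc _) y z = refl

∑-ifPos : ∀ s (w g : ℕ → ℕ) c → (∀ i → w i ≤ 1) → (∀ {i} → i < s → w i ≡ 1 → g i ≡ c) →
          ∑[ i < s ] ifPos (w i) (g i) ≡ ∑ s w * c
∑-ifPos s w g c w≤1 g≡c = trans (∑-cong s summand) (∑-*ʳ s w c)
  where
  summand : ∀ {i} → i < s → ifPos (w i) (g i) ≡ w i * c
  summand {i} i<s with w i in wᵢ | w≤1 i
  ... | zero        | _        = refl
  ... | suc zero    | _        = trans (g≡c i<s wᵢ) (sym (+-identityʳ c))
  ... | suc (suc _) | s≤s ()

_·_ : ∀ {n} → ℕ × Vec ℕ n → ℕ × Vec ℕ n → ℕ × Vec ℕ n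
(c , e) · (d , f) = (c * d , e ⊕ f)

⊗-[] : ∀ {n} (q : Poly n) → q ⊗ [] ≡ []
⊗-[] []      = refl
⊗-[] (_ ∷ q) = ⊗-[] q

coeff-++ : ∀ {n} (a : Vec ℕ n) xs ys → coeff a (xs ++ ys) ≡ coeff a xs + coeff a ys
coeff-++ a xs ys = trans (cong sum (map-++ _ xs ys)) (sum-++ (map _ xs) _)

coeff-⊗-++ : ∀ {n} (a : Vec ℕ n) q r s → coeff a (q ⊗ (r ++ s)) ≡ coeff a (q ⊗ r) + coeff a (q ⊗ s)
coeff-⊗-++ a []      r s = refl
coeff-⊗-++ a (t ∷ q) r s = begin
  coeff a (map (t ·_) (r ++ s) ++ q ⊗ (r ++ s))
    ≡⟨ coeff-++ a (map (t ·_) (r ++ s)) _ ⟩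
  coeff a (map (t ·_) (r ++ s)) + coeff a (q ⊗ (r ++ s))
    ≡⟨ cong₂ _+_ (trans (cong (coeff a) (map-++ (t ·_) r s)) (coeff-++ a (map (t ·_) r) _))
                 (coeff-⊗-++ a q r s) ⟩
  (coeff a (map (t ·_) r) + coeff a (map (t ·_) s)) + (coeff a (q ⊗ r) + coeff a (q ⊗ s))
    ≡⟨ interchange (coeff a (map (t ·_) r)) _ _ _ ⟩
  (coeff a (map (t ·_) r) + coeff a (q ⊗ r)) + (coeff a (map (t ·_) s) + coeff a (q ⊗ s))
    ≡⟨ sym (cong₂ _+_ (coeff-++ a (map (t ·_) r) _) (coeff-++ a (map (t ·_) s) _)) ⟩
  coeff a ((t ∷ q) ⊗ r) + coeff a ((t ∷ q) ⊗ s) ∎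
  where open ≡-Reasoning

coeff-⊗-concatMap : ∀ {n} {A : Set} (a : Vec ℕ n) q (g : A → Poly n) xs →
                    coeff a (q ⊗ concatMap g xs) ≡ sum (map (λ x → coeff a (q ⊗ g x)) xs)
coeff-⊗-concatMap a q g []       = cong (coeff a) (⊗-[] q)
coeff-⊗-concatMap a q g (x ∷ xs) =
  trans (coeff-⊗-++ a q (g x) _) (cong (coeff a (q ⊗ g x) +_) (coeff-⊗-concatMap a q g xs))

termCoeff-⊕-unit : ∀ {n} (a e : Vec ℕ n) i c →
  (if ⌊ ≡-dec _≟_ (e ⊕ unit i) a ⌋ then c * 1 else 0)
    ≡ ifPos (a ‼ toℕ i) (if ⌊ ≡-dec _≟_ e (decrementAt a (toℕ i)) ⌋ then c else 0)
termCoeff-⊕-unit a e i c with a ‼ toℕ i in aᵢ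
... | zero with ≡-dec _≟_ (e ⊕ unit i) a
...   | yes refl = contradiction (trans (sym (‼-⊕-unit e i)) aᵢ) λ ()
...   | no _     = refl
termCoeff-⊕-unit a e i c | suc _
  with ≡-dec _≟_ (e ⊕ unit i) a | ≡-dec _≟_ e (decrementAt a (toℕ i))
... | yes _  | yes _    = *-identityʳ c
... | yes eq | no ≢dec  =
  contradiction (⊕-cancelʳ e _ (unit i) (trans eq (sym (decrementAt-⊕-unit a i aᵢ)))) ≢dec
... | no ≢a  | yes refl = contradiction (decrementAt-⊕-unit a i aᵢ) ≢a
... | no _   | no _     = refl

coeff-⊗-var : ∀ {n} (a : Vec ℕ n) i q →
              coeff a (q ⊗ var i) ≡ ifPos (a ‼ toℕ i) (coeff (decrementAt a (toℕ i)) q)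
coeff-⊗-var a i []            = sym (ifPos-0 (a ‼ toℕ i))
coeff-⊗-var a i ((c , e) ∷ q) =
  trans (cong₂ _+_ (termCoeff-⊕-unit a e i c) (coeff-⊗-var a i q)) (sym (ifPos-+ (a ‼ toℕ i) _ _))

coeff-⊗-partialSum : ∀ {n} (a : Vec ℕ n) q {k} → k ≤ n →
  coeff a (q ⊗ partialSum k) ≡ ∑[ x < k ] ifPos (a ‼ x) (coeff (decrementAt a x) q)
coeff-⊗-partialSum {n} a q {k} k≤n = begin
  coeff a (q ⊗ partialSum k)
    ≡⟨ coeff-⊗-concatMap a q _ (allFin n) ⟩
  sum (map (λ i → coeff a (q ⊗ (if toℕ i <ᵇ k then var i else []))) (allFin n))
    ≡⟨ cong sum (map-cong summand (allFin n)) ⟩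
  sum (map (f ∘ toℕ) (allFin n))
    ≡⟨ sum-allFin n f ⟩
  ∑ n f
    ≡⟨ ∑-if-<ᵇ n k _ k≤n ⟩
  ∑[ x < k ] ifPos (a ‼ x) (coeff (decrementAt a x) q) ∎
  where
  open ≡-Reasoning
  f : ℕ → ℕ
  f x = if x <ᵇ k then ifPos (a ‼ x) (coeff (decrementAt a x) q) else 0
  summand : ∀ i → coeff a (q ⊗ (if toℕ i <ᵇ k then var i else [])) ≡ f (toℕ i)
  summand i with toℕ i <ᵇ k
  ... | true  = coeff-⊗-var a i q
  ... | false = cong (coeff a) (⊗-[] q)

coeff-one : ∀ n → coeff (replicate n 0) (one {n}) ≡ 1
coeff-one n with ≡-dec _≟_ (replicate n 0) (replicate n 0)
... | yes _   = refl
... | no ≢rep = contradiction refl ≢rep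

partialSums : ∀ {n} → ℕ → ℕ → Poly n
partialSums t zero    = one
partialSums t (suc r) = partialSums (suc t) r ⊗ partialSum (suc t)

foldr-partialSum : ∀ {n} r t (f : ℕ → ℕ) → (∀ x → f x ≡ t + x) →
  foldr (λ k acc → acc ⊗ partialSum (suc k)) one (applyUpTo f r) ≡ partialSums {n} t r
foldr-partialSum zero    t f f≗t+ = refl
foldr-partialSum (suc r) t f f≗t+ =
  cong₂ (λ q k → q ⊗ partialSum (suc k))
        (foldr-partialSum r (suc t) (f ∘ suc) (λ x → trans (f≗t+ (suc x)) (+-suc t x)))
        (trans (f≗t+ 0) (+-identityʳ t))

p≡partialSums : ∀ n → p n ≡ partialSums 0 n
p≡partialSums n = foldr-partialSum n 0 (λ x → x) (λ _ → refl)

rising : ℕ → ℕ → ℕ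
rising e zero    = 1
rising e (suc u) = (e + suc u) * rising e u

rising-suc : ∀ e u → rising e (suc u) ≡ suc e * rising (suc e) u
rising-suc e zero    = cong (_* 1) (+-comm e 1)
rising-suc e (suc u) =
  trans (cong ((e + suc (suc u)) *_) (rising-suc e u)) (shuffle e u (rising (suc e) u))
  where
  shuffle : ∀ e u r → (e + suc (suc u)) * (suc e * r) ≡ suc e * ((suc e + suc u) * r)
  shuffle = solve-∀

rising-pascal : ∀ e u → 0 < e + u → ifPos e (rising (pred e) u) + u * rising e (pred u) ≡ rising e u
rising-pascal zero    (suc u) _ = refl
rising-pascal (suc e) zero    _ = refl
rising-pascal (suc e) (suc u) _ =
  trans (cong (_+ suc u * rising (suc e) u) (rising-suc e u)) (sym (*-distribʳ-+ _ (suc e) (suc u)))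

𝟙[_<_] : ℕ → ℕ → ℕ
𝟙[ i < m ] = if i <ᵇ m then 1 else 0

𝟙-< : ∀ {i m} → i < m → 𝟙[ i < m ] ≡ 1
𝟙-< {zero}  {suc m} _         = refl
𝟙-< {suc i} {suc m} (s≤s i<m) = 𝟙-< i<m

𝟙-≥ : ∀ {i m} → m ≤ i → 𝟙[ i < m ] ≡ 0
𝟙-≥ {i}     {zero}  _         = refl
𝟙-≥ {suc i} {suc m} (s≤s m≤i) = 𝟙-≥ m≤i

𝟙-≤1 : ∀ i m → 𝟙[ i < m ] ≤ 1
𝟙-≤1 i m with i <ᵇ m
... | true  = ≤-refl
... | false = z≤n

module Staircase (n′ m j : ℕ) (m+j≡1+n′ : m + j ≡ suc n′) where

  -- b ‼ i is the exponent of x_{i+2} still to be produced once the factors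
  -- x₁, x₁ + x₂, …, x₁ + ⋯ + x_{s+1} have been expanded.
  record Remaining (s : ℕ) (b : Vec ℕ n′) : Set where
    field
      ‼≤1    : ∀ i → b ‼ i ≤ 1
      fresh  : ∀ {i} → s ≤ i → i < m → b ‼ i ≡ 1
      beyond : ∀ {i} → m ≤ i → b ‼ i ≡ 0
  open Remaining

  Remaining-suc : ∀ {s b} → Remaining s b → Remaining (suc s) b
  Remaining-suc R = record { ‼≤1 = ‼≤1 R ; fresh = fresh R ∘ <⇒≤ ; beyond = beyond R }

  Remaining-decrementAt : ∀ {s b i} → i < s → Remaining s b → Remaining s (decrementAt b i)
  Remaining-decrementAt {b = b} {i} i<s R = record
    { ‼≤1   = λ k → ≤-trans (‼-decrementAt-≤ b i k) (‼≤1 R k)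
    ; fresh  = λ s≤k k<m → trans (‼-decrementAt-≢ b (<⇒≢ (<-≤-trans i<s s≤k))) (fresh R s≤k k<m)
    ; beyond = λ m≤k → n≤0⇒n≡0 (≤-trans (‼-decrementAt-≤ b i _) (≤-reflexive (beyond R m≤k)))
    }

  onesThenZeros : Vec ℕ n′
  onesThenZeros = tabulate (λ i → 𝟙[ toℕ i < m ])

  Remaining-initial : m ≤ n′ → Remaining 0 onesThenZeros
  Remaining-initial m≤n′ = record
    { ‼≤1   = λ i → entry i (_≤ 1) (λ _ → 𝟙-≤1 i m) (λ _ → z≤n)
    ; fresh  = λ {i} _ i<m → entry i (_≡ 1) (λ _ → 𝟙-< i<m)
                               (λ n′≤i → contradiction (<-≤-trans i<m m≤n′) (≤⇒≯ n′≤i))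
    ; beyond = λ {i} m≤i → entry i (_≡ 0) (λ _ → 𝟙-≥ m≤i) (λ _ → refl)
    }
    where
    entry : ∀ i (P : ℕ → Set) → (i < n′ → P 𝟙[ i < m ]) → (n′ ≤ i → P 0) →
            P (onesThenZeros ‼ i)
    entry i P inside outside with i <? n′
    ... | yes i<n′ = subst P (sym (‼-tabulate 𝟙[_< m ] i<n′)) (inside i<n′)
    ... | no  i≮n′ = subst P (sym (‼-out onesThenZeros n′≤i)) (outside n′≤i)
      where n′≤i = ≮⇒≥ i≮n′

  coeff-peel : ∀ {s r} e (b : Vec ℕ n′) → s + suc r ≡ n′ →
    coeff (e ∷ b) (partialSums (suc s) (suc r))
      ≡ ifPos e (coeff (pred e ∷ b) (partialSums (suc (suc s)) r))
        + ∑[ i < s ] ifPos (b ‼ i) (coeff (e ∷ decrementAt b i) (partialSums (suc (suc s)) r))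
        + ifPos (b ‼ s) (coeff (e ∷ decrementAt b s) (partialSums (suc (suc s)) r))
  coeff-peel {s} {r} e b s+r≡n′ =
    trans (coeff-⊗-partialSum (e ∷ b) Q (s≤s 1+s≤n′))
          (trans (cong (first +_) (∑-snoc s summand)) (sym (+-assoc first (∑ s summand) (summand s))))
    where
    Q = partialSums (suc (suc s)) r
    first = ifPos e (coeff (pred e ∷ b) Q)
    summand : ℕ → ℕ
    summand i = ifPos (b ‼ i) (coeff (e ∷ decrementAt b i) Q)
    1+s≤n′ : suc s ≤ n′
    1+s≤n′ = ≤-trans (s≤s (m≤m+n s r)) (≤-reflexive (trans (sym (+-suc s r)) s+r≡n′))

  CoeffFormula : ℕ → ℕ → Set
  CoeffFormula s r = ∀ e u (b : Vec ℕ n′) → Remaining s b → ∑ s (b ‼_) ≡ u → e + u + (m ∸ s) ≡ r →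
                     coeff (e ∷ b) (partialSums (suc s) r) ≡ j ^ (m ∸ s) * rising e u

  formula-done : ∀ {s} → s ≡ n′ → CoeffFormula s 0
  formula-done {s} s≡n′ e u b _ ∑b≡u deg = begin
    coeff (e ∷ b) one                 ≡⟨ cong (λ a → coeff a one) (cong₂ _∷_ e≡0 b≡0) ⟩
    coeff (replicate (suc n′) 0) one  ≡⟨ coeff-one (suc n′) ⟩
    1                                 ≡⟨ sym (cong₂ (λ f u → j ^ f * rising e u) m∸s≡0 u≡0) ⟩
    j ^ (m ∸ s) * rising e u          ∎
    where
    open ≡-Reasoning
    e+u≡0 = m+n≡0⇒m≡0 (e + u) deg
    m∸s≡0 = m+n≡0⇒n≡0 (e + u) deg
    e≡0 = m+n≡0⇒m≡0 e e+u≡0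
    u≡0 = m+n≡0⇒n≡0 e e+u≡0
    b≡0 = ∑-‼≡0 b (subst (λ s → ∑ s (b ‼_) ≡ 0) s≡n′ (trans ∑b≡u u≡0))

  degree-fresh : ∀ {s r e u} → s < m → s + suc r ≡ n′ → e + u + (m ∸ s) ≡ suc r → suc (e + u) ≡ j
  degree-fresh {s} {r} {e} {u} s<m s+r≡n′ deg = sym (+-cancelˡ-≡ (m ∸ s + s) j (suc (e + u)) (begin
    m ∸ s + s + j                ≡⟨ cong (_+ j) (m∸n+n≡m (<⇒≤ s<m)) ⟩
    m + j                        ≡⟨ m+j≡1+n′ ⟩
    suc n′                       ≡⟨ cong suc (sym s+r≡n′) ⟩
    suc (s + suc r)              ≡⟨ cong (λ x → suc (s + x)) (sym deg) ⟩
    suc (s + (e + u + (m ∸ s)))  ≡⟨ rearrange s (e + u) (m ∸ s) ⟩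
    m ∸ s + s + suc (e + u)      ∎))
    where
    open ≡-Reasoning
    rearrange : ∀ s x d → suc (s + (x + d)) ≡ d + s + suc x
    rearrange = solve-∀

  formula-fresh : ∀ {s r} → s < m → s + suc r ≡ n′ → CoeffFormula (suc s) r → CoeffFormula s (suc r)
  formula-fresh {s} {r} s<m s+r≡n′ IH e u b R ∑b≡u deg = begin
      coeff (e ∷ b) (partialSums (suc s) (suc r))
    ≡⟨ coeff-peel e b s+r≡n′ ⟩
      ifPos e (coeff (pred e ∷ b) Q) + ∑[ i < s ] ifPos (b ‼ i) (coeff (e ∷ decrementAt b i) Q)
        + ifPos (b ‼ s) (coeff (e ∷ decrementAt b s) Q)
    ≡⟨ cong₂ _+_ (cong₂ _+_ (first e deg′) middle) last ⟩
      e * X + u * X + X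
    ≡⟨ collect e u X ⟩
      suc (e + u) * X
    ≡⟨ cong (_* X) (degree-fresh {e = e} {u} s<m s+r≡n′ deg) ⟩
      j * (j ^ f′ * rising e u)
    ≡⟨ sym (*-assoc j (j ^ f′) (rising e u)) ⟩
      j ^ suc f′ * rising e u
    ≡⟨ cong (λ f → j ^ f * rising e u) (sym m∸s≡1+f′) ⟩
      j ^ (m ∸ s) * rising e u ∎
    where
    open ≡-Reasoning
    Q  = partialSums (suc (suc s)) r
    f′ = m ∸ suc s
    X  = j ^ f′ * rising e u
    R′ = Remaining-suc R
    m∸s≡1+f′ : m ∸ s ≡ suc f′
    m∸s≡1+f′ = +-∸-assoc 1 s<m
    deg′ : e + u + f′ ≡ r
    deg′ = suc-injective (trans (sym (+-suc (e + u) f′)) (trans (cong (e + u +_) (sym m∸s≡1+f′)) deg))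
    bₛ≡1 : b ‼ s ≡ 1
    bₛ≡1 = fresh R ≤-refl s<m
    ∑b≡1+u : ∑ (suc s) (b ‼_) ≡ suc u
    ∑b≡1+u = trans (∑-snoc s (b ‼_)) (trans (cong₂ _+_ ∑b≡u bₛ≡1) (+-comm u 1))
    collect : ∀ e u x → e * x + u * x + x ≡ suc (e + u) * x
    collect = solve-∀

    first : ∀ e → e + u + f′ ≡ r → ifPos e (coeff (pred e ∷ b) Q) ≡ e * (j ^ f′ * rising e u)
    first zero    _   = refl
    first (suc e) deg = begin
        coeff (e ∷ b) Q
      ≡⟨ IH e (suc u) b R′ ∑b≡1+u (trans (cong (_+ f′) (+-suc e u)) deg) ⟩
        j ^ f′ * rising e (suc u)
      ≡⟨ cong (j ^ f′ *_) (rising-suc e u) ⟩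
        j ^ f′ * (suc e * rising (suc e) u)
      ≡⟨ x*[y*z]≡y*[x*z] (j ^ f′) (suc e) _ ⟩
        suc e * (j ^ f′ * rising (suc e) u) ∎

    middle : ∑[ i < s ] ifPos (b ‼ i) (coeff (e ∷ decrementAt b i) Q) ≡ u * X
    middle = trans (∑-ifPos s (b ‼_) _ X (‼≤1 R) used) (cong (_* X) ∑b≡u)
      where
      used : ∀ {i} → i < s → b ‼ i ≡ 1 → coeff (e ∷ decrementAt b i) Q ≡ X
      used i<s bᵢ≡1 = IH e u _ (Remaining-decrementAt (m<n⇒m<1+n i<s) R′)
        (suc-injective (trans (∑-decrementAt b (m<n⇒m<1+n i<s) bᵢ≡1) ∑b≡1+u)) deg′

    last : ifPos (b ‼ s) (coeff (e ∷ decrementAt b s) Q) ≡ X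
    last = trans (cong (λ x → ifPos x (coeff (e ∷ decrementAt b s) Q)) bₛ≡1)
      (IH e u _ (Remaining-decrementAt ≤-refl R′)
         (suc-injective (trans (∑-decrementAt b ≤-refl bₛ≡1) ∑b≡1+u)) deg′)

  formula-exhausted : ∀ {s r} → m ≤ s → s + suc r ≡ n′ → CoeffFormula (suc s) r → CoeffFormula s (suc r)
  formula-exhausted {s} {r} m≤s s+r≡n′ IH e u b R ∑b≡u deg = begin
      coeff (e ∷ b) (partialSums (suc s) (suc r))
    ≡⟨ coeff-peel e b s+r≡n′ ⟩
      ifPos e (coeff (pred e ∷ b) Q) + ∑[ i < s ] ifPos (b ‼ i) (coeff (e ∷ decrementAt b i) Q)
        + ifPos (b ‼ s) (coeff (e ∷ decrementAt b s) Q)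
    ≡⟨ cong₂ _+_ (cong₂ _+_ (first e e+u≡1+r) middle) last ⟩
      ifPos e (rising (pred e) u) + u * rising e (pred u) + 0
    ≡⟨ +-identityʳ _ ⟩
      ifPos e (rising (pred e) u) + u * rising e (pred u)
    ≡⟨ rising-pascal e u (subst (0 <_) (sym e+u≡1+r) z<s) ⟩
      rising e u
    ≡⟨ sym (trans (cong (λ f → j ^ f * rising e u) (m≤n⇒m∸n≡0 m≤s)) (*-identityˡ _)) ⟩
      j ^ (m ∸ s) * rising e u ∎
    where
    open ≡-Reasoning
    Q  = partialSums (suc (suc s)) r
    R′ = Remaining-suc R
    e+u≡1+r : e + u ≡ suc r
    e+u≡1+r = trans (sym (+-identityʳ _)) (trans (cong (e + u +_) (sym (m≤n⇒m∸n≡0 m≤s))) deg)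
    bₛ≡0 : b ‼ s ≡ 0
    bₛ≡0 = beyond R m≤s
    ∑b≡u+0 : ∑ (suc s) (b ‼_) ≡ u
    ∑b≡u+0 = trans (∑-snoc s (b ‼_)) (trans (cong₂ _+_ ∑b≡u bₛ≡0) (+-identityʳ u))
    IH′ : ∀ e u b → Remaining (suc s) b → ∑ (suc s) (b ‼_) ≡ u → e + u ≡ r → coeff (e ∷ b) Q ≡ rising e u
    IH′ e u b R ∑≡u deg =
      trans (IH e u b R ∑≡u (trans (cong (e + u +_) m∸1+s≡0) (trans (+-identityʳ _) deg)))
            (trans (cong (λ f → j ^ f * rising e u) m∸1+s≡0) (*-identityˡ _))
      where
      m∸1+s≡0 : m ∸ suc s ≡ 0
      m∸1+s≡0 = m≤n⇒m∸n≡0 (m≤n⇒m≤1+n m≤s)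

    first : ∀ e → e + u ≡ suc r → ifPos e (coeff (pred e ∷ b) Q) ≡ ifPos e (rising (pred e) u)
    first zero    _   = refl
    first (suc e) deg = IH′ e u b R′ ∑b≡u+0 (suc-injective deg)

    middle : ∑[ i < s ] ifPos (b ‼ i) (coeff (e ∷ decrementAt b i) Q) ≡ u * rising e (pred u)
    middle = trans (∑-ifPos s (b ‼_) _ (rising e (pred u)) (‼≤1 R) used) (cong (_* _) ∑b≡u)
      where
      used : ∀ {i} → i < s → b ‼ i ≡ 1 → coeff (e ∷ decrementAt b i) Q ≡ rising e (pred u)
      used {i} i<s bᵢ≡1 = trans
        (IH′ e _ _ (Remaining-decrementAt (m<n⇒m<1+n i<s) R′) refl
             (suc-injective (trans (sym (+-suc e _)) (trans (cong (e +_) 1+∑≡u) e+u≡1+r))))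
        (cong (rising e ∘ pred) 1+∑≡u)
        where
        1+∑≡u : suc (∑ (suc s) (decrementAt b i ‼_)) ≡ u
        1+∑≡u = trans (∑-decrementAt b (m<n⇒m<1+n i<s) bᵢ≡1) ∑b≡u+0

    last : ifPos (b ‼ s) (coeff (e ∷ decrementAt b s) Q) ≡ 0
    last = cong (λ x → ifPos x (coeff (e ∷ decrementAt b s) Q)) bₛ≡0

  coeff-formula : ∀ r s → s + r ≡ n′ → CoeffFormula s r
  coeff-formula zero    s s+0≡n′ = formula-done (trans (sym (+-identityʳ s)) s+0≡n′)
  coeff-formula (suc r) s s+r≡n′ with s <? m
  ... | yes s<m = formula-fresh s<m s+r≡n′ (coeff-formula r (suc s) (trans (sym (+-suc s r)) s+r≡n′))
  ... | no  s≮m = formula-exhausted (≮⇒≥ s≮m) s+r≡n′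
                    (coeff-formula r (suc s) (trans (sym (+-suc s r)) s+r≡n′))

lemma5 : (n j : ℕ) → 1 ≤ j → j ≤ n → c n (vecJ n j) ≡ j ^ (n ∸ j)
lemma5 (suc n′) (suc j′) (s≤s z≤n) j≤n = begin
  -- vecJ (suc n′) (suc j′) is definitionally suc j′ ∷ b.
    coeff (suc j′ ∷ b) (p (suc n′))
  ≡⟨ cong (coeff (suc j′ ∷ b)) (p≡partialSums (suc n′)) ⟩
    coeff (suc j′ ∷ b) (partialSums 0 (suc n′))
  ≡⟨ coeff-⊗-partialSum (suc j′ ∷ b) (partialSums 1 n′) (s≤s z≤n) ⟩
    coeff (j′ ∷ b) (partialSums 1 n′) + 0
  ≡⟨ +-identityʳ _ ⟩
    coeff (j′ ∷ b) (partialSums 1 n′)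
  ≡⟨ coeff-formula n′ 0 refl j′ 0 b (Remaining-initial (m∸n≤m n′ j′)) refl degree ⟩
    suc j′ ^ m * 1
  ≡⟨ *-identityʳ _ ⟩
    suc j′ ^ m ∎
  where
  open ≡-Reasoning
  m = n′ ∸ j′
  m+j≡n = m∸n+n≡m j≤n
  open Staircase n′ m (suc j′) m+j≡n
  b = onesThenZeros
  degree : j′ + 0 + m ≡ n′
  degree = suc-injective (trans (shuffle j′ m) m+j≡n)
    where
    shuffle : ∀ j m → suc (j + 0 + m) ≡ m + suc j
    shuffle = solve-∀
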